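{- For integers $r\ge 2$ and $2\le t\le r$, the $r$-graph $H^r_{t+1}$ is not $(r-1)$-shadow-homomorphic to $H^r_t$.
   Context: An $r$-graph is an $r$-uniform hypergraph. $H^r_t$ denotes the unique (up to isomorphism) $r$-graph with $r+1$ vertices and $t$ edges. For an $r$-graph $H$, $\partial_k H=\bigcup_{e\in E(H)}\binom{e}{k}$ is its $k$-shadow. An $r$-graph $A$ is $k$-shadow-homomorphic to an $r$-graph $B$ if one can choose for each $S\in\partial_k A$ a set $f(S)\in\partial_k B$ and a bijection $g_S:S\to f(S)$ such that for every edge $e\in E(A)$ there exist an edge $e'\in E(B)$ and a bijection $g:e\to e'$ with $g|_S=g_S$ for every $S\in\binom{e}{k}$. -}

module Defs where

open import Data.Nat using (ℕ; _<_)
open import Data.Fin using (Fin; toℕ)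
open import Data.Fin.Subset using (Subset; _∈_; _⊆_; ∣_∣; ∁; ⁅_⁆)
open import Data.Product using (Σ; ∃; ∃-syntax; _×_)
open import Relation.Binary.PropositionalEquality using (_≡_)

record Hypergraph : Set₁ where
  field
    V    : ℕ
    Edge : Subset V → Set
open Hypergraph public

Uniform : ℕ → Hypergraph → Set
Uniform r H = ∀ e → Edge H e → ∣ e ∣ ≡ r

InShadow : ℕ → (H : Hypergraph) → Subset (V H) → Set
InShadow k H S = (∣ S ∣ ≡ k) × (∃[ e ] (Edge H e × S ⊆ e))

BijOn : ∀ {n m} → (S : Subset n) → (T : Subset m) →
        ((x : Fin n) → x ∈ S → Fin m) → Set
BijOn {n} {m} S T g =
  (∀ x (p : x ∈ S) → g x p ∈ T) ×
  (∀ x y (p : x ∈ S) (q : y ∈ S) → g x p ≡ g y q → x ≡ y) ×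
  (∀ (y : Fin m) → y ∈ T → ∃[ x ] Σ (x ∈ S) (λ p → g x p ≡ y))

-- A is k-shadow-homomorphic to B.  The maps f and g_S are given on all
-- subsets, but constrained only on the members of ∂_k A.
ShadowHom : ℕ → Hypergraph → Hypergraph → Set
ShadowHom k A B =
  Σ (Subset (V A) → Subset (V B)) λ f →
  Σ ((S : Subset (V A)) → (x : Fin (V A)) → x ∈ S → Fin (V B)) λ gS →
    (∀ S → InShadow k A S → InShadow k B (f S) × BijOn S (f S) (gS S)) ×
    (∀ e → Edge A e →
       ∃[ e′ ] (Edge B e′ ×
         Σ ((x : Fin (V A)) → x ∈ e → Fin (V B)) λ g →
           BijOn e e′ g ×
           (∀ S → InShadow k A S → S ⊆ e →
              ∀ x (p : x ∈ S) (q : x ∈ e) → g x q ≡ gS S x p)))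

-- H^r_t : vertex set Fin (r+1); edges are the complements ∁ ⁅ i ⁆ of the
-- singletons {i} for the t vertices i with toℕ i < t  (for t ≤ r+1 this is
-- an r-graph on r+1 vertices with exactly t edges, unique up to isomorphism).
H : ℕ → ℕ → Hypergraph
H r t = record
  { V    = Data.Nat.suc r
  ; Edge = λ e → ∃[ i ] (toℕ i < t × e ≡ ∁ ⁅ i ⁆)
  }

-- Each edge ∁{a} of H^r_{t+1} is carried by a bijection g_a onto an edge of H^r_t, and
-- two such bijections agree on the (r-1)-set ∁{a,b} shared by their domains.  If ∁{i}
-- and ∁{j} had the same image, surjectivity of g_j and injectivity of g_i would force
-- g_i(j) = g_j(i); a third edge ∁{w} then gives g_w(i) = g_j(i) = g_i(j) = g_w(j),
-- contradicting injectivity of g_w.  So the t+1 edges have t+1 distinct images, while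
-- H^r_t has only t edges.
module Submission where

open import Defs
open import Data.Nat using (ℕ; _≤_; _∸_; _+_)
open import Relation.Nullary using (¬_)

open import Data.Nat.Base using (suc; s≤s; z<s; _<_)
open import Data.Nat.Properties using (+-comm; +-monoˡ-≤; m<m+n)
open import Data.Fin.Base using (Fin; zero; suc; toℕ; inject≤; fromℕ<)
open import Data.Fin.Properties
  using (_≟_; toℕ<n; toℕ-inject≤; toℕ-injective; inject≤-injective; fromℕ<-injective; <⇒notInjective)
open import Data.Fin.Subset using (Subset; _∈_; _⊆_; ∣_∣; ∁; ⁅_⁆; _∪_)
open import Data.Fin.Subset.Properties
  using ( x∈⁅x⁆; x∈⁅y⁆⇒x≡y; ∪-identityˡ; ∪-identityʳ; ∣⁅x⁆∣≡1; ∣∁p∣≡n∸∣p∣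
        ; x∈∁p⇒x∉p; x∉p⇒x∈∁p; p⊆q⇒∁p⊇∁q; p⊆p∪q; q⊆p∪q; x∈p∪q⁻ )
open import Data.Vec.Properties.WithK using ([]=-irrelevant)
open import Data.Product using (∃-syntax; _×_; _,_; proj₁; proj₂)
open import Data.Sum using ([_,_]′)
open import Data.Empty using (⊥; ⊥-elim)
open import Relation.Binary.PropositionalEquality
  using (_≡_; _≢_; refl; sym; trans; cong; subst; module ≡-Reasoning)
open import Relation.Nullary using (yes; no; contradiction)
open import Function.Base using (_∘′_)

private
  variable
    n m : ℕ

x≢y⇒x∈∁⁅y⁆ : {x y : Fin n} → x ≢ y → x ∈ ∁ ⁅ y ⁆
x≢y⇒x∈∁⁅y⁆ {y = y} x≢y = x∉p⇒x∈∁p (λ x∈⁅y⁆ → x≢y (x∈⁅y⁆⇒x≡y y x∈⁅y⁆))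

x∈∁⁅y⁆⇒x≢y : {x y : Fin n} → x ∈ ∁ ⁅ y ⁆ → x ≢ y
x∈∁⁅y⁆⇒x≢y {x = x} x∈∁⁅y⁆ refl = x∈∁p⇒x∉p x∈∁⁅y⁆ (x∈⁅x⁆ x)

x∈∁p∧x∈∁q⇒x∈∁p∪q : {x : Fin n} {p q : Subset n} → x ∈ ∁ p → x ∈ ∁ q → x ∈ ∁ (p ∪ q)
x∈∁p∧x∈∁q⇒x∈∁p∪q {p = p} {q} x∈∁p x∈∁q =
  x∉p⇒x∈∁p (λ x∈p∪q → [ x∈∁p⇒x∉p x∈∁p , x∈∁p⇒x∉p x∈∁q ]′ (x∈p∪q⁻ p q x∈p∪q))

∣⁅x⁆∪⁅y⁆∣≡2 : (x y : Fin n) → x ≢ y → ∣ ⁅ x ⁆ ∪ ⁅ y ⁆ ∣ ≡ 2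
∣⁅x⁆∪⁅y⁆∣≡2 zero    zero    x≢y = contradiction refl x≢y
∣⁅x⁆∪⁅y⁆∣≡2 zero    (suc y) _   rewrite ∪-identityˡ ⁅ y ⁆ = cong suc (∣⁅x⁆∣≡1 y)
∣⁅x⁆∪⁅y⁆∣≡2 (suc x) zero    _   rewrite ∪-identityʳ ⁅ x ⁆ = cong suc (∣⁅x⁆∣≡1 x)
∣⁅x⁆∪⁅y⁆∣≡2 (suc x) (suc y) x≢y = ∣⁅x⁆∪⁅y⁆∣≡2 x y (λ x≡y → x≢y (cong suc x≡y))

∣∁⁅x⁆∪⁅y⁆∣≡n∸2 : (x y : Fin n) → x ≢ y → ∣ ∁ (⁅ x ⁆ ∪ ⁅ y ⁆) ∣ ≡ n ∸ 2
∣∁⁅x⁆∪⁅y⁆∣≡n∸2 {n} x y x≢y = begin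
  ∣ ∁ (⁅ x ⁆ ∪ ⁅ y ⁆) ∣  ≡⟨ ∣∁p∣≡n∸∣p∣ (⁅ x ⁆ ∪ ⁅ y ⁆) ⟩
  n ∸ ∣ ⁅ x ⁆ ∪ ⁅ y ⁆ ∣  ≡⟨ cong (n ∸_) (∣⁅x⁆∪⁅y⁆∣≡2 x y x≢y) ⟩
  n ∸ 2                  ∎
  where open ≡-Reasoning

∃≢-both : (x y : Fin (3 + n)) → ∃[ z ] z ≢ x × z ≢ y
∃≢-both zero          zero          = suc zero , (λ ()) , (λ ())
∃≢-both zero          (suc zero)    = suc (suc zero) , (λ ()) , (λ ())
∃≢-both zero          (suc (suc _)) = suc zero , (λ ()) , (λ ())
∃≢-both (suc zero)    zero          = suc (suc zero) , (λ ()) , (λ ())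
∃≢-both (suc (suc _)) zero          = suc zero , (λ ()) , (λ ())
∃≢-both (suc _)       (suc _)       = zero , (λ ()) , (λ ())

Agree : {S S′ : Subset n} → ((x : Fin n) → x ∈ S → Fin m) → ((x : Fin n) → x ∈ S′ → Fin m) → Set
Agree g h = ∀ x p q → g x p ≡ h x q

module _ {i j : Fin n} where

  bij-onto-same-set⇒swap : ∀ {T : Subset m} {g h} →
    BijOn (∁ ⁅ i ⁆) T g → BijOn (∁ ⁅ j ⁆) T h → Agree g h →
    ∀ p q → g j p ≡ h i q
  bij-onto-same-set⇒swap {h = h} (g∈T , g-inj , _) (_ , _ , h-onto) g≈h p q
    with h-onto _ (g∈T j p)
  ... | y , y∈∁⁅j⁆ , hy≡gj with y ≟ i
  ...   | yes refl = trans (sym hy≡gj) (cong (h i) ([]=-irrelevant y∈∁⁅j⁆ q))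
  ...   | no y≢i   = contradiction (g-inj y j y∈∁⁅i⁆ p gy≡gj) (x∈∁⁅y⁆⇒x≢y y∈∁⁅j⁆)
    where
      y∈∁⁅i⁆ = x≢y⇒x∈∁⁅y⁆ y≢i
      gy≡gj  = trans (g≈h y y∈∁⁅i⁆ y∈∁⁅j⁆) hy≡gj

  bij-onto-same-set⇒⊥ : ∀ {w : Fin n} {T T′ : Subset m} {g h k} →
    BijOn (∁ ⁅ i ⁆) T g → BijOn (∁ ⁅ j ⁆) T h → BijOn (∁ ⁅ w ⁆) T′ k →
    Agree g h → Agree k g → Agree k h →
    i ≢ j → w ≢ i → w ≢ j → ⊥
  bij-onto-same-set⇒⊥ {g = g} {h} {k} g-bij h-bij (_ , k-inj , _) g≈h k≈g k≈h i≢j w≢i w≢j =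
    i≢j (k-inj i j i∈∁⁅w⁆ j∈∁⁅w⁆ (begin
      k i i∈∁⁅w⁆  ≡⟨ k≈h i i∈∁⁅w⁆ i∈∁⁅j⁆ ⟩
      h i i∈∁⁅j⁆  ≡⟨ bij-onto-same-set⇒swap g-bij h-bij g≈h j∈∁⁅i⁆ i∈∁⁅j⁆ ⟨
      g j j∈∁⁅i⁆  ≡⟨ k≈g j j∈∁⁅w⁆ j∈∁⁅i⁆ ⟨
      k j j∈∁⁅w⁆  ∎))
    where
      open ≡-Reasoning
      i∈∁⁅w⁆ = x≢y⇒x∈∁⁅y⁆ (w≢i ∘′ sym)
      j∈∁⁅w⁆ = x≢y⇒x∈∁⁅y⁆ (w≢j ∘′ sym)
      i∈∁⁅j⁆ = x≢y⇒x∈∁⁅y⁆ i≢j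
      j∈∁⁅i⁆ = x≢y⇒x∈∁⁅y⁆ (i≢j ∘′ sym)

module EdgeMaps {k : ℕ} {A B : Hypergraph} (hom : ShadowHom k A B) where

  private
    edgeCondition = proj₂ (proj₂ (proj₂ hom))

  image : ∀ e → Edge A e → Subset (V B)
  image e e∈A = proj₁ (edgeCondition e e∈A)

  image∈B : ∀ e (e∈A : Edge A e) → Edge B (image e e∈A)
  image∈B e e∈A = proj₁ (proj₂ (edgeCondition e e∈A))

  map : ∀ e → Edge A e → (x : Fin (V A)) → x ∈ e → Fin (V B)
  map e e∈A = proj₁ (proj₂ (proj₂ (edgeCondition e e∈A)))

  map-bij : ∀ e (e∈A : Edge A e) → BijOn e (image e e∈A) (map e e∈A)
  map-bij e e∈A = proj₁ (proj₂ (proj₂ (proj₂ (edgeCondition e e∈A))))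

  map-agree-on-shadow : ∀ e e′ (e∈A : Edge A e) (e′∈A : Edge A e′) S →
    InShadow k A S → S ⊆ e → S ⊆ e′ →
    ∀ x → x ∈ S → (p : x ∈ e) (p′ : x ∈ e′) → map e e∈A x p ≡ map e′ e′∈A x p′
  map-agree-on-shadow e e′ e∈A e′∈A S S∈∂A S⊆e S⊆e′ x x∈S p p′ =
    trans (toGS e e∈A S S∈∂A S⊆e x x∈S p) (sym (toGS e′ e′∈A S S∈∂A S⊆e′ x x∈S p′))
    where toGS = λ e e∈A → proj₂ (proj₂ (proj₂ (proj₂ (edgeCondition e e∈A))))

module EdgeMapsOfH {r s : ℕ} {B : Hypergraph} (s≤1+r : s ≤ suc r)
                   (hom : ShadowHom (r ∸ 1) (H r s) B) where

  open EdgeMaps hom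

  vertex : Fin s → Fin (suc r)
  vertex a = inject≤ a s≤1+r

  vertex-injective : ∀ {a b} → a ≢ b → vertex a ≢ vertex b
  vertex-injective {a} {b} a≢b = a≢b ∘′ inject≤-injective s≤1+r s≤1+r a b

  edge∈H : ∀ a → Edge (H r s) (∁ ⁅ vertex a ⁆)
  edge∈H a = vertex a , subst (_< s) (sym (toℕ-inject≤ a s≤1+r)) (toℕ<n a) , refl

  image-of : Fin s → Subset (V B)
  image-of a = image _ (edge∈H a)

  image-of∈B : ∀ a → Edge B (image-of a)
  image-of∈B a = image∈B _ (edge∈H a)

  map-of : (a : Fin s) → (x : Fin (suc r)) → x ∈ ∁ ⁅ vertex a ⁆ → Fin (V B)
  map-of a = map _ (edge∈H a)

  map-of-agree : ∀ {a b} → a ≢ b → Agree (map-of a) (map-of b)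
  map-of-agree {a} {b} a≢b x p q =
    map-agree-on-shadow _ _ (edge∈H a) (edge∈H b) S S∈∂H ∁⊆∁⁅a⁆ ∁⊆∁⁅b⁆ x
      (x∈∁p∧x∈∁q⇒x∈∁p∪q p q) p q
    where
      S = ∁ (⁅ vertex a ⁆ ∪ ⁅ vertex b ⁆)
      ∁⊆∁⁅a⁆ = p⊆q⇒∁p⊇∁q (p⊆p∪q ⁅ vertex b ⁆)
      ∁⊆∁⁅b⁆ = p⊆q⇒∁p⊇∁q (q⊆p∪q ⁅ vertex a ⁆ ⁅ vertex b ⁆)
      S∈∂H : InShadow (r ∸ 1) (H r s) S
      S∈∂H = ∣∁⁅x⁆∪⁅y⁆∣≡n∸2 _ _ (vertex-injective a≢b) , _ , edge∈H a , ∁⊆∁⁅a⁆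

  image-of-injective : 3 ≤ s → ∀ {a b} → image-of a ≡ image-of b → a ≡ b
  image-of-injective (s≤s (s≤s (s≤s _))) {a} {b} eq with a ≟ b | ∃≢-both a b
  ... | yes a≡b | _ = a≡b
  ... | no a≢b | c , c≢a , c≢b = ⊥-elim
    (bij-onto-same-set⇒⊥ (map-bij _ (edge∈H a)) b-bij (map-bij _ (edge∈H c))
      (map-of-agree a≢b) (map-of-agree c≢a) (map-of-agree c≢b)
      (vertex-injective a≢b) (vertex-injective c≢a) (vertex-injective c≢b))
    where
      b-bij = subst (λ T → BijOn _ T (map-of b)) (sym eq) (map-bij _ (edge∈H b))

proposition4p4 : (r t : ℕ) → 2 ≤ r → 2 ≤ t → t ≤ r →
    ¬ ShadowHom (r ∸ 1) (H r (t + 1)) (H r t)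
proposition4p4 r t _ 2≤t t≤r hom = <⇒notInjective (m<m+n t z<s) label-injective
  where
    open EdgeMapsOfH (subst (_≤ suc r) (+-comm 1 t) (s≤s t≤r)) hom

    label : Fin (t + 1) → Fin t
    label a = fromℕ< (proj₁ (proj₂ (image-of∈B a)))

    label-injective : ∀ {a b} → label a ≡ label b → a ≡ b
    label-injective {a} {b} eq with image-of∈B a | image-of∈B b
    ... | i , i<t , image-a≡∁⁅i⁆ | j , j<t , image-b≡∁⁅j⁆ =
      image-of-injective (+-monoˡ-≤ 1 2≤t) (begin
        image-of a  ≡⟨ image-a≡∁⁅i⁆ ⟩
        ∁ ⁅ i ⁆     ≡⟨ cong (λ v → ∁ ⁅ v ⁆) (toℕ-injective (fromℕ<-injective _ _ i<t j<t eq)) ⟩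
        ∁ ⁅ j ⁆     ≡⟨ image-b≡∁⁅j⁆ ⟨
        image-of b  ∎)
      where open ≡-Reasoning
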